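{- Define $\eta\in(\mathbb B\times\mathbb B)^L$ by $\eta_{(s,n)}=([s_{>n}\equiv0],[s_{<n}\equiv0])$, where $[P]=\top$ if $P$ holds and $\bot$ otherwise. Then: - $\Omega_\leftrightarrow$ is the orbit closure of $\eta$ under the translation action of $L$; - $\eta$ is the only configuration $\zeta\in\Omega_\leftrightarrow$ satisfying $\zeta_1=(\top,\top)$.
   Context: **The group.** $L$ is the lamplighter group. Its elements are pairs $(s,n)$ with $n\in\mathbb Z$ and $s\colon\mathbb Z+\frac12\to\mathbb Z/2$ finitely supported. The product is $(r,m)(s,n)=(t,m+n)$ with $t_i=r_i+s_{i-m}$, the generators are $a=(0,1)$, $b=(\delta_{1/2},1)$, and the identity is $1=(0,0)$. $s_{>n}$ and $s_{<n}$ denote the restrictions of $s$ to $\{i>n\}$ and to $\{i<n\}$. **Action.** $L$ acts on $Y^L$ (product topology) by $(g\eta)_h=\eta_{g^{ -1}h}$. Let $\mathbb B=\{\bot,\top\}$. For a configuration $\zeta$ and $g\in L$, write $(\alpha,\beta,\gamma,\delta)=(\zeta_g,\zeta_{gab^{ -1}},\zeta_{ga},\zeta_{gb})$. **The subshifts.** - $\Omega_\leftarrow\subseteq\mathbb B^L$: for all $g$, $\alpha\vee\beta\Rightarrow\gamma\wedge\delta$ and $\gamma\vee\delta\Rightarrow\alpha\ne\beta$. - $\Omega_\rightarrow\subseteq\mathbb B^L$: for all $g$, $\gamma\vee\delta\Rightarrow\alpha\wedge\beta$ and $\alpha\vee\beta\Rightarrow\gamma\ne\delta$. - $\Omega_\leftrightarrow\subseteq(\mathbb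 B\times\mathbb B)^L$: the configurations whose first projection is in $\Omega_\leftarrow$, whose second projection is in $\Omega_\rightarrow$, and such that $\alpha=(\top,\top)\iff\gamma=(\top,\top)$ for all $g$. -}

module Defs where

open import Data.Bool using (Bool; true; false; _∧_; _∨_; _xor_; not)
open import Data.Integer using (ℤ; _+_; _-_; -_; _≤_; _<_; _≤?_; _<?_; 0ℤ; 1ℤ)
import Data.Integer as ℤ
import Data.Bool as 𝔹
open import Data.List using (List; []; _∷_; _++_; map)
open import Data.List.Membership.Propositional using (_∈_)
open import Data.List.Relation.Unary.All as All using (All; all?)
open import Data.List.Relation.Unary.Any using (here; there)
open import Data.Product using (_×_; _,_; proj₁; proj₂; ∃-syntax)
open import Relation.Nullary using (Dec; yes; no; ¬_; does)
open import Relation.Nullary.Decidable using (_→-dec_)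
open import Relation.Unary using (Pred; Decidable)
open import Relation.Binary.PropositionalEquality using (_≡_; _≢_; refl; sym; trans)
open import Data.Empty using (⊥-elim)
import Agda.Primitive

-- Finitely supported maps  ℤ + 1/2 → ℤ/2.
-- The half-integer i + 1/2 is encoded by the integer i.
-- A finitely supported map is encoded by a finite list of integers;
-- the value at i is the parity of the number of occurrences of i.

bit : List ℤ → ℤ → Bool
bit []       i = false
bit (j ∷ js) i = does (i ℤ.≟ j) xor bit js i

record Lamp : Set where
  constructor ⟨_,_⟩
  field
    lamps : List ℤ
    pos   : ℤ
open Lamp public

_≈_ : Lamp → Lamp → Set
g ≈ h = (pos g ≡ pos h) × (∀ i → bit (lamps g) i ≡ bit (lamps h) i)

-- (r,m)(s,n) = (t, m+n),  t_i = r_i + s_{i-m}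
_∙_ : Lamp → Lamp → Lamp
⟨ r , m ⟩ ∙ ⟨ s , n ⟩ = ⟨ r ++ map (λ j → j + m) s , m + n ⟩

-- (s,n)⁻¹ = (t, -n),  t_j = s_{j+n}
_⁻¹ : Lamp → Lamp
⟨ s , n ⟩ ⁻¹ = ⟨ map (λ j → j - n) s , - n ⟩

infixl 7 _∙_
infix 8 _⁻¹

𝟙 : Lamp
𝟙 = ⟨ [] , 0ℤ ⟩

a : Lamp
a = ⟨ [] , 1ℤ ⟩

-- b = (δ_{1/2}, 1); the half-integer 1/2 is encoded by 0
b : Lamp
b = ⟨ 0ℤ ∷ [] , 1ℤ ⟩

bit-true⇒∈ : ∀ xs i → bit xs i ≡ true → i ∈ xs
bit-true⇒∈ []       i ()
bit-true⇒∈ (j ∷ js) i eq with i ℤ.≟ j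
... | yes p = here p
... | no _  = there (bit-true⇒∈ js i eq)

vanishesOn? : {Q : Pred ℤ Agda.Primitive.lzero} → Decidable Q → ∀ xs →
              Dec (∀ i → Q i → bit xs i ≡ false)
vanishesOn? {Q} Q? xs with all? (λ j → Q? j →-dec (bit xs j 𝔹.≟ false)) xs
... | yes allp = yes f
  where
  f : ∀ i → Q i → bit xs i ≡ false
  f i qi with bit xs i in eq
  ... | false = refl
  ... | true  = trans (sym eq) (All.lookup allp (bit-true⇒∈ xs i eq) qi)
... | no ¬allp = no (λ H → ¬allp (All.tabulate (λ {j} _ → H j)))

-- [P] for P = "s_{>n} ≡ 0": half-integer i+1/2 > n  iff  n ≤ i
zeroAbove : Lamp → Bool
zeroAbove g = does (vanishesOn? (λ i → pos g ≤? i) (lamps g))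

-- [P] for P = "s_{<n} ≡ 0": half-integer i+1/2 < n  iff  i < n
zeroBelow : Lamp → Bool
zeroBelow g = does (vanishesOn? (λ i → i <? pos g) (lamps g))

η : Lamp → Bool × Bool
η g = zeroAbove g , zeroBelow g

-- a function on representatives is a configuration on L iff it respects ≈
Respects : {Y : Set} → (Lamp → Y) → Set
Respects ζ = ∀ {g h} → g ≈ h → ζ g ≡ ζ h

shift : {Y : Set} → Lamp → (Lamp → Y) → (Lamp → Y)
shift g ζ h = ζ (g ⁻¹ ∙ h)

Ω← : (Lamp → Bool) → Set
Ω← ζ = ∀ g →
  ((ζ g ∨ ζ (g ∙ a ∙ b ⁻¹)) ≡ true → (ζ (g ∙ a) ∧ ζ (g ∙ b)) ≡ true) ×
  ((ζ (g ∙ a) ∨ ζ (g ∙ b)) ≡ true → ζ g ≢ ζ (g ∙ a ∙ b ⁻¹))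

Ω→ : (Lamp → Bool) → Set
Ω→ ζ = ∀ g →
  ((ζ (g ∙ a) ∨ ζ (g ∙ b)) ≡ true → (ζ g ∧ ζ (g ∙ a ∙ b ⁻¹)) ≡ true) ×
  ((ζ g ∨ ζ (g ∙ a ∙ b ⁻¹)) ≡ true → ζ (g ∙ a) ≢ ζ (g ∙ b))

Ω↔ : (Lamp → Bool × Bool) → Set
Ω↔ ζ = Ω← (λ g → proj₁ (ζ g)) × Ω→ (λ g → proj₂ (ζ g)) ×
       (∀ g → (ζ g ≡ (true , true) → ζ (g ∙ a) ≡ (true , true)) ×
              (ζ (g ∙ a) ≡ (true , true) → ζ g ≡ (true , true)))

-- ζ lies in the closure (product topology) of the orbit {g ξ : g ∈ L}:
-- every basic cylinder around ζ (fixing finitely many coordinates) meets the orbit.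
InOrbitClosure : {Y : Set} → (Lamp → Y) → (Lamp → Y) → Set
InOrbitClosure ξ ζ = ∀ (F : List Lamp) → ∃[ g ] (∀ {h} → h ∈ F → ζ h ≡ shift g ξ h)

-- Read a configuration of Ω← on the binary tree whose vertices are the pairs (s restricted to [n, ∞) , n),
-- the children of (s , n + 1) being the two states of the lamp at n: the defining condition says that a vertex
-- is marked iff exactly one of its children is. The marked vertices are therefore closed upwards and there is
-- at most one on each level, so they are either empty or a single branch; Ω→ is the same after reflecting the
-- lamps. If ζ 𝟙 = (⊤ , ⊤), the condition linking the two coordinates marks every vertex ([] , n) in both trees,
-- which pins both branches down to those of η.
-- For the orbit closure take a window [−N , N] containing the finitely many positions and lamps in question.
-- If both branches pass through ([] , N), following them down to level −N gives g₀ with ζ g₀ = (⊤ , ⊤), and ζ is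
-- the translate of η by g₀. Otherwise one coordinate of ζ is constantly ⊥ on the window, and η translated by a
-- lamp configuration at position 0 matches ζ there: it follows the surviving branch, and a lamp just outside
-- the window switches the other coordinate off.

module Submission where

open import Defs
open import Data.Bool using (Bool; true; false; _∧_; _∨_; _xor_; not) renaming (_≟_ to _≟ᵇ_)
open import Data.Bool.Properties
  using (xor-assoc; xor-comm; xor-same; xor-identityʳ; ¬-not; not-involutive; ∨-identityʳ; ∧-zeroʳ)
open import Data.Integer
  using (ℤ; _+_; _-_; -_; _⊔_; _≤_; _<_; _≤?_; _<?_; _≟_; 0ℤ; 1ℤ; +_; ∣_∣; -[1+_]; +≤+; -≤-; -≤+; +<+; -<-; -<+)
import Data.Integer.Properties as ℤ
open import Data.Integer.Tactic.RingSolver using (solve-∀)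
open import Data.Nat using (ℕ; zero; suc; s≤s)
import Data.Nat as ℕ
import Data.Nat.Properties as ℕ
open import Data.List using (List; []; _∷_; _++_; map; filter)
open import Data.List.Properties using (++-identityʳ; map-++)
open import Data.List.Membership.Propositional using (_∈_)
open import Data.List.Relation.Unary.Any using (here; there)
open import Data.List.Relation.Unary.All as All using (All; []; _∷_)
open import Data.List.Extrema.Nat using (max; xs≤max)
open import Data.List.Membership.Propositional.Properties using (∈-map⁺)
open import Data.List.Relation.Unary.All.Properties using (all-filter)
open import Data.Product using (_×_; _,_; proj₁; proj₂; ∃-syntax; swap)
open import Data.Sum using (inj₁; inj₂)
open import Function using (_∘_; id; case_of_)
open import Function.Bundles using (_⇔_; mk⇔; Equivalence)
open import Relation.Nullary using (Dec; yes; no; ¬_; does; contradiction)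
open import Relation.Nullary.Decidable using (dec-true; dec-false; does-⇔)
open import Level using (0ℓ)
open import Relation.Unary using (Pred; Decidable)
open import Relation.Binary.PropositionalEquality

private
  variable
    s t x : List ℤ
    i j m n : ℤ

open Equivalence using (to; from)

⇔true⇒≡ : ∀ {x y : Bool} → x ≡ true ⇔ y ≡ true → x ≡ y
⇔true⇒≡ {true}  {true}  _ = refl
⇔true⇒≡ {true}  {false} e = sym (to e refl)
⇔true⇒≡ {false} {true}  e = from e refl
⇔true⇒≡ {false} {false} _ = refl

xor-cancelʳ : ∀ x y → (x xor y) xor y ≡ x
xor-cancelʳ x y = trans (xor-assoc x y y) (trans (cong (x xor_) (xor-same y)) (xor-identityʳ x))

xor≡false⇔≡ : ∀ {x y} → x xor y ≡ false ⇔ x ≡ y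
xor≡false⇔≡ {x} {y} = mk⇔ (to′ x y) (λ { refl → xor-same x })
  where
  to′ : ∀ x y → x xor y ≡ false → x ≡ y
  to′ true  true  _ = refl
  to′ false false _ = refl

does≡true⇔ : ∀ {P : Set} (P? : Dec P) → does P? ≡ true ⇔ P
does≡true⇔ P? = mk⇔ (from′ P?) (dec-true P?)
  where
  from′ : ∀ {P} (P? : Dec P) → does P? ≡ true → P
  from′ (yes p) _ = p

n<n+1 : n < n + 1ℤ
n<n+1 {n} = subst (n <_) (ℤ.+-comm 1ℤ n) (ℤ.suc[i]≤j⇒i<j ℤ.≤-refl)

<⇒+1≤ : i < n → i + 1ℤ ≤ n
<⇒+1≤ {i} {n} i<n = subst (_≤ n) (ℤ.+-comm 1ℤ i) (ℤ.i<j⇒suc[i]≤j i<n)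

+1≤⇒< : i + 1ℤ ≤ n → i < n
+1≤⇒< {i} {n} p = ℤ.suc[i]≤j⇒i<j (subst (_≤ n) (ℤ.+-comm i 1ℤ) p)

≤∧≢⇒+1≤ : n ≤ i → i ≢ n → n + 1ℤ ≤ i
≤∧≢⇒+1≤ n≤i i≢n = <⇒+1≤ (ℤ.≤∧≢⇒< n≤i (i≢n ∘ sym))

upward-induction : (P : ℤ → Set) → P m → (∀ n → P n → P (n + 1ℤ)) → m ≤ n → P n
upward-induction {m} {n} P base step m≤n = subst P reach (go ∣ m - n ∣)
  where
  m+[n-m]≡n : ∀ m n → m + (n - m) ≡ n
  m+[n-m]≡n = solve-∀
  reach : m + + ∣ m - n ∣ ≡ n
  reach = trans (cong (λ z → m + z) (ℤ.∣-∣-≤ m≤n)) (m+[n-m]≡n m n)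
  +suc : ∀ k → m + + suc k ≡ m + + k + 1ℤ
  +suc k = trans (cong (λ z → m + (+ z)) (ℕ.+-comm 1 k)) (sym (ℤ.+-assoc m (+ k) 1ℤ))
  go : ∀ k → P (m + + k)
  go zero    = subst P (sym (ℤ.+-identityʳ m)) base
  go (suc k) = subst P (sym (+suc k)) (step _ (go k))

downward-induction : (P : ℤ → Set) → P m → (∀ n → P (n + 1ℤ) → P n) → n ≤ m → P n
downward-induction {m} {n} P top step n≤m =
  upward-induction (λ k → P k → P n) id (λ k Pk⇒Pn → Pk⇒Pn ∘ step k) n≤m top

-- Lamp configurations

bit-++ : ∀ s t i → bit (s ++ t) i ≡ bit s i xor bit t i
bit-++ []      t i = refl
bit-++ (j ∷ s) t i =
  trans (cong (does (i ≟ j) xor_) (bit-++ s t i)) (sym (xor-assoc (does (i ≟ j)) (bit s i) (bit t i)))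

bit-map : ∀ {φ ψ : ℤ → ℤ} → (∀ j → ψ (φ j) ≡ j) → (∀ i → φ (ψ i) ≡ i) →
          ∀ s i → bit (map φ s) i ≡ bit s (ψ i)
bit-map         ψφ φψ []      i = refl
bit-map {φ} {ψ} ψφ φψ (j ∷ s) i = cong₂ _xor_ (does-⇔ i≡φj⇔ψi≡j (i ≟ φ j) (ψ i ≟ j)) (bit-map ψφ φψ s i)
  where
  i≡φj⇔ψi≡j : i ≡ φ j ⇔ ψ i ≡ j
  i≡φj⇔ψi≡j = mk⇔ (λ e → trans (cong ψ e) (ψφ j)) (λ e → trans (sym (φψ i)) (cong φ e))

bit-translate : ∀ c s i → bit (map (λ j → j + c) s) i ≡ bit s (i - c)
bit-translate c = bit-map (λ j → j+c-c≡j j c) (λ i → i-c+c≡i i c)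
  where
  j+c-c≡j : ∀ j c → j + c - c ≡ j
  j+c-c≡j = solve-∀
  i-c+c≡i : ∀ i c → i - c + c ≡ i
  i-c+c≡i = solve-∀

bit-snoc : ∀ s j i → bit (s ++ j ∷ []) i ≡ bit (j ∷ s) i
bit-snoc s j i = trans (bit-++ s (j ∷ []) i)
  (trans (cong (bit s i xor_) (xor-identityʳ (does (i ≟ j)))) (xor-comm (bit s i) (does (i ≟ j))))

bit-cons-self : ∀ n s → bit (n ∷ s) n ≡ not (bit s n)
bit-cons-self n s = cong (_xor bit s n) (dec-true (n ≟ n) refl)

bit-cons-other : ∀ j s i → i ≢ j → bit (j ∷ s) i ≡ bit s i
bit-cons-other j s i i≢j = cong (_xor bit s i) (dec-false (i ≟ j) i≢j)

bit-swap : ∀ j k s i → bit (j ∷ k ∷ s) i ≡ bit (k ∷ j ∷ s) i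
bit-swap j k s i = begin
  does (i ≟ j) xor (does (i ≟ k) xor bit s i)   ≡⟨ xor-assoc (does (i ≟ j)) _ _ ⟨
  (does (i ≟ j) xor does (i ≟ k)) xor bit s i   ≡⟨ cong (_xor bit s i) (xor-comm (does (i ≟ j)) _) ⟩
  (does (i ≟ k) xor does (i ≟ j)) xor bit s i   ≡⟨ xor-assoc (does (i ≟ k)) _ _ ⟩
  does (i ≟ k) xor (does (i ≟ j) xor bit s i)   ∎
  where open ≡-Reasoning

-- The half-integer j + 1/2 is reflected to -(j + 1/2) = mirror j + 1/2.
mirror : ℤ → ℤ
mirror j = - (j + 1ℤ)

mirror-involutive : ∀ j → mirror (mirror j) ≡ j
mirror-involutive = unfolded
  where
  unfolded : ∀ j → - (- (j + 1ℤ) + 1ℤ) ≡ j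
  unfolded = solve-∀

mirror+1 : ∀ n → mirror n + 1ℤ ≡ - n
mirror+1 = unfolded
  where
  unfolded : ∀ n → - (n + 1ℤ) + 1ℤ ≡ - n
  unfolded = solve-∀

bit-mirror : ∀ s i → bit (map mirror s) i ≡ bit s (mirror i)
bit-mirror = bit-map mirror-involutive mirror-involutive

bit-mirror² : ∀ s i → bit (map mirror (map mirror s)) i ≡ bit s i
bit-mirror² s i =
  trans (bit-mirror (map mirror s) i) (trans (bit-mirror s (mirror i)) (cong (bit s) (mirror-involutive i)))

mirror-≤ : m ≤ i → mirror i < - m
mirror-≤ m≤i = ℤ.neg-mono-< (ℤ.≤-<-trans m≤i n<n+1)

mirror-< : i < m → - m ≤ mirror i
mirror-< i<m = ℤ.neg-mono-≤ (<⇒+1≤ i<m)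

AgreeOn : Pred ℤ 0ℓ → List ℤ → List ℤ → Set
AgreeOn Q s t = ∀ i → Q i → bit s i ≡ bit t i

AgreeFrom : ℤ → List ℤ → List ℤ → Set
AgreeFrom m = AgreeOn (m ≤_)

AgreeBelow : ℤ → List ℤ → List ℤ → Set
AgreeBelow m = AgreeOn (_< m)

AgreeFrom-mono : ∀ s t → m ≤ n → AgreeFrom m s t → AgreeFrom n s t
AgreeFrom-mono s t m≤n agree i n≤i = agree i (ℤ.≤-trans m≤n n≤i)

AgreeFrom-mirror : ∀ m s t → AgreeFrom m s t → AgreeBelow (- m) (map mirror s) (map mirror t)
AgreeFrom-mirror m s t agree i i<-m =
  trans (bit-mirror s i) (trans (agree (mirror i) m≤mirror-i) (sym (bit-mirror t i)))
  where
  m≤mirror-i : m ≤ mirror i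
  m≤mirror-i = subst (_≤ mirror i) (ℤ.neg-involutive m) (mirror-< i<-m)

AgreeBelow-mirror : ∀ m s t → AgreeBelow m s t → AgreeFrom (- m) (map mirror s) (map mirror t)
AgreeBelow-mirror m s t agree i -m≤i =
  trans (bit-mirror s i) (trans (agree (mirror i) mirror-i<m) (sym (bit-mirror t i)))
  where
  mirror-i<m : mirror i < m
  mirror-i<m = subst (mirror i <_) (ℤ.neg-involutive m) (mirror-≤ -m≤i)

cons-agree-above : ∀ n s → AgreeFrom (n + 1ℤ) (n ∷ s) s
cons-agree-above n s i n+1≤i = bit-cons-other n s i λ { refl → ℤ.<-irrefl refl (+1≤⇒< n+1≤i) }

module _ {P : Pred ℤ 0ℓ} (P? : Decidable P) where

  bit-filter-∈ : ∀ s {i} → P i → bit (filter P? s) i ≡ bit s i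
  bit-filter-∈ []      Pi = refl
  bit-filter-∈ (j ∷ s) {i} Pi with P? j
  ... | yes _  = cong (does (i ≟ j) xor_) (bit-filter-∈ s Pi)
  ... | no ¬Pj = trans (bit-filter-∈ s Pi) (sym (bit-cons-other j s i λ { refl → ¬Pj Pi }))

  bit-filter-∉ : ∀ s {i} → ¬ P i → bit (filter P? s) i ≡ false
  bit-filter-∉ []      ¬Pi = refl
  bit-filter-∉ (j ∷ s) {i} ¬Pi with P? j
  ... | yes Pj = trans (bit-cons-other j (filter P? s) i λ { refl → ¬Pi Pj }) (bit-filter-∉ s ¬Pi)
  ... | no _   = bit-filter-∉ s ¬Pi

span : List ℤ → ℕ
span []      = 0
span (j ∷ s) = suc ∣ j ∣ ℕ.+ span s

∈⇒∣∣<span : i ∈ s → ∣ i ∣ ℕ.< span s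
∈⇒∣∣<span {s = j ∷ s} (here refl) = ℕ.m≤m+n (suc ∣ j ∣) (span s)
∈⇒∣∣<span {s = j ∷ s} (there i∈s) = ℕ.<-≤-trans (∈⇒∣∣<span i∈s) (ℕ.m≤n+m (span s) (suc ∣ j ∣))

∣∣<⇒bounds : ∀ {B} → ∣ i ∣ ℕ.< B → - + B < i × i < + B
∣∣<⇒bounds {+ _}      {suc B} (s≤s p) = -<+ , +<+ (s≤s p)
∣∣<⇒bounds { -[1+ _ ]} {suc B} (s≤s p) = -<- p , -<+

span-bounds : ∀ s {B} → span s ℕ.≤ B → AgreeFrom (+ B) s [] × AgreeBelow (- + B) s []
span-bounds s {B} span≤B = above , below
  where
  on⇒inside : ∀ i → bit s i ≡ true → - + B < i × i < + B
  on⇒inside i on = ∣∣<⇒bounds (ℕ.<-≤-trans (∈⇒∣∣<span (bit-true⇒∈ s i on)) span≤B)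
  above : AgreeFrom (+ B) s []
  above i B≤i = ¬-not λ on → ℤ.<⇒≱ (proj₂ (on⇒inside i on)) B≤i
  below : AgreeBelow (- + B) s []
  below i i<-B = ¬-not λ on → ℤ.<-asym (proj₁ (on⇒inside i on)) i<-B

-- The lamplighter group

≈-refl : ∀ {g} → g ≈ g
≈-refl = refl , λ _ → refl

≈-sym : ∀ {g h} → g ≈ h → h ≈ g
≈-sym (p , q) = sym p , λ i → sym (q i)

≈-trans : ∀ {g h k} → g ≈ h → h ≈ k → g ≈ k
≈-trans (p , q) (p′ , q′) = trans p p′ , λ i → trans (q i) (q′ i)

bit-∙ : ∀ g h i → bit (lamps (g ∙ h)) i ≡ bit (lamps g) i xor bit (lamps h) (i - pos g)
bit-∙ g h i = trans (bit-++ (lamps g) _ i) (cong (bit (lamps g) i xor_) (bit-translate (pos g) (lamps h) i))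

∙-cong : ∀ {g g′ h h′} → g ≈ g′ → h ≈ h′ → (g ∙ h) ≈ (g′ ∙ h′)
∙-cong {g} {g′} {h} {h′} (p , q) (p′ , q′) = cong₂ _+_ p p′ , λ i → begin
  bit (lamps (g ∙ h)) i                              ≡⟨ bit-∙ g h i ⟩
  bit (lamps g) i xor bit (lamps h) (i - pos g)      ≡⟨ cong₂ _xor_ (q i) (q′ (i - pos g)) ⟩
  bit (lamps g′) i xor bit (lamps h′) (i - pos g)    ≡⟨ cong (λ c → bit (lamps g′) i xor bit (lamps h′) (i - c)) p ⟩
  bit (lamps g′) i xor bit (lamps h′) (i - pos g′)   ≡⟨ bit-∙ g′ h′ i ⟨
  bit (lamps (g′ ∙ h′)) i                            ∎
  where open ≡-Reasoning

∙-assoc : ∀ g h k → ((g ∙ h) ∙ k) ≈ (g ∙ (h ∙ k))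
∙-assoc g h k = ℤ.+-assoc (pos g) (pos h) (pos k) , λ i → begin
  bit (lamps ((g ∙ h) ∙ k)) i
    ≡⟨ bit-∙ (g ∙ h) k i ⟩
  bit (lamps (g ∙ h)) i xor bit (lamps k) (i - (pos g + pos h))
    ≡⟨ cong₂ _xor_ (bit-∙ g h i) (cong (bit (lamps k)) (i-[m+n]≡i-m-n i (pos g) (pos h))) ⟩
  (bit (lamps g) i xor bit (lamps h) (i - pos g)) xor bit (lamps k) (i - pos g - pos h)
    ≡⟨ xor-assoc (bit (lamps g) i) _ _ ⟩
  bit (lamps g) i xor (bit (lamps h) (i - pos g) xor bit (lamps k) (i - pos g - pos h))
    ≡⟨ cong (bit (lamps g) i xor_) (bit-∙ h k (i - pos g)) ⟨
  bit (lamps g) i xor bit (lamps (h ∙ k)) (i - pos g)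
    ≡⟨ bit-∙ g (h ∙ k) i ⟨
  bit (lamps (g ∙ (h ∙ k))) i
    ∎
  where
  open ≡-Reasoning
  i-[m+n]≡i-m-n : ∀ i m n → i - (m + n) ≡ i - m - n
  i-[m+n]≡i-m-n = solve-∀

[g∙h]∙k∙l≈g∙[h∙k∙l] : ∀ g h k l → ((g ∙ h) ∙ k ∙ l) ≈ (g ∙ (h ∙ k ∙ l))
[g∙h]∙k∙l≈g∙[h∙k∙l] g h k l = ≈-trans {(g ∙ h) ∙ k ∙ l} {(g ∙ (h ∙ k)) ∙ l} {g ∙ (h ∙ k ∙ l)}
  (∙-cong {(g ∙ h) ∙ k} {g ∙ (h ∙ k)} {l} {l} (∙-assoc g h k) (≈-refl {l})) (∙-assoc g (h ∙ k) l)

g∙[g⁻¹∙h]≈h : ∀ g h → (g ∙ (g ⁻¹ ∙ h)) ≈ h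
g∙[g⁻¹∙h]≈h g h = n+[-n+m]≡m (pos g) (pos h) , λ i → begin
  bit (lamps (g ∙ (g ⁻¹ ∙ h))) i
    ≡⟨ bit-∙ g (g ⁻¹ ∙ h) i ⟩
  bit (lamps g) i xor bit (lamps (g ⁻¹ ∙ h)) (i - pos g)
    ≡⟨ cong (bit (lamps g) i xor_) (bit-∙ (g ⁻¹) h (i - pos g)) ⟩
  bit (lamps g) i xor (bit (lamps (g ⁻¹)) (i - pos g) xor bit (lamps h) (i - pos g - - pos g))
    ≡⟨ cong (λ x → bit (lamps g) i xor (x xor bit (lamps h) (i - pos g - - pos g)))
            (bit-translate (- pos g) (lamps g) (i - pos g)) ⟩
  bit (lamps g) i xor (bit (lamps g) (i - pos g - - pos g) xor bit (lamps h) (i - pos g - - pos g))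
    ≡⟨ cong (λ j → bit (lamps g) i xor (bit (lamps g) j xor bit (lamps h) j)) (i-n-[-n]≡i i (pos g)) ⟩
  bit (lamps g) i xor (bit (lamps g) i xor bit (lamps h) i)
    ≡⟨ xor-assoc (bit (lamps g) i) _ _ ⟨
  (bit (lamps g) i xor bit (lamps g) i) xor bit (lamps h) i
    ≡⟨ cong (_xor bit (lamps h) i) (xor-same (bit (lamps g) i)) ⟩
  bit (lamps h) i
    ∎
  where
  open ≡-Reasoning
  n+[-n+m]≡m : ∀ n m → n + (- n + m) ≡ m
  n+[-n+m]≡m = solve-∀
  i-n-[-n]≡i : ∀ i n → i - n - - n ≡ i
  i-n-[-n]≡i = solve-∀

∙-identityʳ : ∀ g → (g ∙ 𝟙) ≈ g
∙-identityʳ g = ℤ.+-identityʳ (pos g) , λ i → cong (λ l → bit l i) (++-identityʳ (lamps g))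

⁻¹∙-at-origin : ∀ t s m → (⟨ t , 0ℤ ⟩ ⁻¹ ∙ ⟨ s , m ⟩) ≈ ⟨ t ++ s , m ⟩
⁻¹∙-at-origin t s m = ℤ.+-identityˡ m , λ i → begin
  bit (lamps (⟨ t , 0ℤ ⟩ ⁻¹ ∙ ⟨ s , m ⟩)) i
    ≡⟨ bit-∙ (⟨ t , 0ℤ ⟩ ⁻¹) ⟨ s , m ⟩ i ⟩
  bit (lamps (⟨ t , 0ℤ ⟩ ⁻¹)) i xor bit s (i - 0ℤ)
    ≡⟨ cong₂ _xor_ (bit-translate 0ℤ t i) refl ⟩
  bit t (i - 0ℤ) xor bit s (i - 0ℤ)
    ≡⟨ cong (λ j → bit t j xor bit s j) (ℤ.+-identityʳ i) ⟩
  bit t i xor bit s i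
    ≡⟨ bit-++ t s i ⟨
  bit (t ++ s) i
    ∎
  where open ≡-Reasoning

∙a-normal : ∀ s n → (⟨ s , n ⟩ ∙ a) ≈ ⟨ s , n + 1ℤ ⟩
∙a-normal s n = refl , λ i → cong (λ l → bit l i) (++-identityʳ s)

∙b-normal : ∀ s n → (⟨ s , n ⟩ ∙ b) ≈ ⟨ n ∷ s , n + 1ℤ ⟩
∙b-normal s n = refl , λ i → trans (bit-snoc s (0ℤ + n) i) (cong (λ j → bit (j ∷ s) i) (ℤ.+-identityˡ n))

∙ab⁻¹-normal : ∀ s n → (⟨ s , n ⟩ ∙ a ∙ b ⁻¹) ≈ ⟨ n ∷ s , n ⟩
∙ab⁻¹-normal s n = n+1-1≡n n , λ i →
  trans (bit-snoc (s ++ []) _ i) (cong₂ (λ j l → bit (j ∷ l) i) (-1+[n+1]≡n n) (++-identityʳ s))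
  where
  n+1-1≡n : ∀ n → n + 1ℤ + - 1ℤ ≡ n
  n+1-1≡n = solve-∀
  -1+[n+1]≡n : ∀ n → 0ℤ - 1ℤ + (n + 1ℤ) ≡ n
  -1+[n+1]≡n = solve-∀

-- The configuration η

TT : Bool × Bool
TT = true , true

zeroAbove-true : ∀ s m → zeroAbove ⟨ s , m ⟩ ≡ true ⇔ AgreeFrom m s []
zeroAbove-true s m = does≡true⇔ (vanishesOn? (m ≤?_) s)

zeroBelow-true : ∀ s m → zeroBelow ⟨ s , m ⟩ ≡ true ⇔ AgreeBelow m s []
zeroBelow-true s m = does≡true⇔ (vanishesOn? (_<? m) s)

AgreeFrom-++ : ∀ m t s → AgreeFrom m (t ++ s) [] ⇔ AgreeFrom m t s
AgreeFrom-++ m t s = mk⇔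
  (λ z i m≤i → to xor≡false⇔≡ (trans (sym (bit-++ t s i)) (z i m≤i)))
  (λ z i m≤i → trans (bit-++ t s i) (from xor≡false⇔≡ (z i m≤i)))

vanishesOn-local : ∀ {Q} (Q? : Decidable Q) s t → AgreeOn Q s t →
                   does (vanishesOn? Q? s) ≡ does (vanishesOn? Q? t)
vanishesOn-local Q? s t agree = does-⇔
  (mk⇔ (λ z i q → trans (sym (agree i q)) (z i q)) (λ z i q → trans (agree i q) (z i q)))
  (vanishesOn? Q? s) (vanishesOn? Q? t)

zeroAbove-local : ∀ m s t → AgreeFrom m s t → zeroAbove ⟨ s , m ⟩ ≡ zeroAbove ⟨ t , m ⟩
zeroAbove-local m = vanishesOn-local (m ≤?_)

zeroBelow-local : ∀ m s t → AgreeBelow m s t → zeroBelow ⟨ s , m ⟩ ≡ zeroBelow ⟨ t , m ⟩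
zeroBelow-local m = vanishesOn-local (_<? m)

zeroBelow-mirror : ∀ s m → zeroBelow ⟨ s , m ⟩ ≡ zeroAbove ⟨ map mirror s , - m ⟩
zeroBelow-mirror s m = does-⇔ (mk⇔ (AgreeBelow-mirror m s []) unmirror)
  (vanishesOn? (_<? m) s) (vanishesOn? (- m ≤?_) (map mirror s))
  where
  unmirror : AgreeFrom (- m) (map mirror s) [] → AgreeBelow m s []
  unmirror z i i<m = trans (sym (bit-mirror² s i))
    (AgreeFrom-mirror (- m) (map mirror s) [] z i (subst (i <_) (sym (ℤ.neg-involutive m)) i<m))

η-respects : Respects η
η-respects {⟨ s , m ⟩} {⟨ t , .m ⟩} (refl , q) =
  cong₂ _,_ (zeroAbove-local m s t (λ i _ → q i)) (zeroBelow-local m s t (λ i _ → q i))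

η≡TT⇔ : ∀ s m → η ⟨ s , m ⟩ ≡ TT ⇔ (∀ i → bit s i ≡ false)
η≡TT⇔ s m = mk⇔
  (λ e i → case i <? m of λ
    { (yes i<m) → to (zeroBelow-true s m) (cong proj₂ e) i i<m
    ; (no i≮m)  → to (zeroAbove-true s m) (cong proj₁ e) i (ℤ.≮⇒≥ i≮m) })
  (λ z → cong₂ _,_ (from (zeroAbove-true s m) (λ i _ → z i))
                   (from (zeroBelow-true s m) (λ i _ → z i)))

zeroAbove-off : ∀ s {m} j → m ≤ j → bit s j ≡ true → zeroAbove ⟨ s , m ⟩ ≡ false
zeroAbove-off s {m} j m≤j on =
  ¬-not λ z → case trans (sym on) (to (zeroAbove-true s m) z j m≤j) of λ ()

zeroAbove-step : ∀ s n → bit s n ≡ false → zeroAbove ⟨ s , n ⟩ ≡ zeroAbove ⟨ s , n + 1ℤ ⟩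
zeroAbove-step s n off = ⇔true⇒≡ (mk⇔
  (λ z → from (zeroAbove-true s (n + 1ℤ)) (AgreeFrom-mono s [] (ℤ.<⇒≤ n<n+1) (to (zeroAbove-true s n) z)))
  (λ z → from (zeroAbove-true s n) (extend (to (zeroAbove-true s (n + 1ℤ)) z))))
  where
  extend : AgreeFrom (n + 1ℤ) s [] → AgreeFrom n s []
  extend z i n≤i with i ≟ n
  ... | yes refl = off
  ... | no i≢n   = z i (≤∧≢⇒+1≤ n≤i i≢n)

zeroAbove-unfold : ∀ s n → zeroAbove ⟨ s , n ⟩ ≡ not (bit s n) ∧ zeroAbove ⟨ s , n + 1ℤ ⟩
zeroAbove-unfold s n = by-lamp (bit s n) refl
  where
  by-lamp : ∀ x → bit s n ≡ x → zeroAbove ⟨ s , n ⟩ ≡ not x ∧ zeroAbove ⟨ s , n + 1ℤ ⟩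
  by-lamp true  on  = zeroAbove-off s n ℤ.≤-refl on
  by-lamp false off = zeroAbove-step s n off

-- Branches of the tree of lamp configurations

-- Ω← ξ g  is  Cell (ξ g) (ξ (g ∙ a ∙ b ⁻¹)) (ξ (g ∙ a)) (ξ (g ∙ b))  and
-- Ω→ ξ g  is  Cell (ξ (g ∙ a)) (ξ (g ∙ b)) (ξ g) (ξ (g ∙ a ∙ b ⁻¹)).
Cell : Bool → Bool → Bool → Bool → Set
Cell α β γ δ = ((α ∨ β) ≡ true → (γ ∧ δ) ≡ true) × ((γ ∨ δ) ≡ true → α ≢ β)

cell⇒ : ∀ α β γ δ → Cell α β γ δ → (γ ≡ α ∨ β) × (δ ≡ γ) × (α ∧ β ≡ false)
cell⇒ true  false true  true  _        = refl , refl , refl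
cell⇒ false true  true  true  _        = refl , refl , refl
cell⇒ false false false false _        = refl , refl , refl
cell⇒ true  true  true  true  (_ , h)  = contradiction refl (h refl)
cell⇒ true  true  true  false (h , _)  = case h refl of λ ()
cell⇒ true  true  false _     (h , _)  = case h refl of λ ()
cell⇒ true  false true  false (h , _)  = case h refl of λ ()
cell⇒ true  false false _     (h , _)  = case h refl of λ ()
cell⇒ false true  true  false (h , _)  = case h refl of λ ()
cell⇒ false true  false _     (h , _)  = case h refl of λ ()
cell⇒ false false true  _     (_ , h)  = contradiction refl (h refl)
cell⇒ false false false true  (_ , h)  = contradiction refl (h refl)

cell⇐ : ∀ {α β γ δ} → γ ≡ α ∨ β → δ ≡ γ → α ∧ β ≡ false → Cell α β γ δ
cell⇐ {true}  {false} refl refl _ = (λ _ → refl) , λ _ ()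
cell⇐ {false} {true}  refl refl _ = (λ _ → refl) , λ _ ()
cell⇐ {false} {false} refl refl _ = (λ ()) , λ ()

Cell-resp : ∀ {α β γ δ α′ β′ γ′ δ′} → α ≡ α′ → β ≡ β′ → γ ≡ γ′ → δ ≡ δ′ →
            Cell α β γ δ → Cell α′ β′ γ′ δ′
Cell-resp refl refl refl refl c = c

-- f s n marks the vertex (s restricted to [n, ∞) , n) of the binary tree in which the children of
-- (s , n + 1) are (s , n) and (n ∷ s , n).
record IsBranch (f : List ℤ → ℤ → Bool) : Set where
  field
    respects : ∀ {s t} n → (∀ i → bit s i ≡ bit t i) → f s n ≡ f t n
    cell     : ∀ s n → Cell (f s n) (f (n ∷ s) n) (f s (n + 1ℤ)) (f (n ∷ s) (n + 1ℤ))

module Branch {f : List ℤ → ℤ → Bool} (branch : IsBranch f) where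
  open IsBranch branch

  private
    cell-equations : ∀ s n → (f s (n + 1ℤ) ≡ f s n ∨ f (n ∷ s) n) × (f (n ∷ s) (n + 1ℤ) ≡ f s (n + 1ℤ)) ×
                             (f s n ∧ f (n ∷ s) n ≡ false)
    cell-equations s n = cell⇒ _ _ _ _ (cell s n)

  parent : ∀ s n → f s (n + 1ℤ) ≡ f s n ∨ f (n ∷ s) n
  parent s n = proj₁ (cell-equations s n)

  parent-forgets : ∀ s n → f (n ∷ s) (n + 1ℤ) ≡ f s (n + 1ℤ)
  parent-forgets s n = proj₁ (proj₂ (cell-equations s n))

  children-exclusive : ∀ s n → f s n ∧ f (n ∷ s) n ≡ false
  children-exclusive s n = proj₂ (proj₂ (cell-equations s n))

  ancestor : f s n ≡ true → n ≤ m → f s m ≡ true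
  ancestor {s} fs = upward-induction (λ k → f s k ≡ true) fs
    (λ k fsk → trans (parent s k) (cong (_∨ f (k ∷ s) k) fsk))

  flip-below : j < m → ∀ s → f (j ∷ s) m ≡ f s m
  flip-below {j} j<m =
    upward-induction (λ k → ∀ s → f (j ∷ s) k ≡ f s k) (λ s → parent-forgets s j) step (<⇒+1≤ j<m)
    where
    step : ∀ k → (∀ s → f (j ∷ s) k ≡ f s k) → ∀ s → f (j ∷ s) (k + 1ℤ) ≡ f s (k + 1ℤ)
    step k ih s = begin
      f (j ∷ s) (k + 1ℤ)               ≡⟨ parent (j ∷ s) k ⟩
      f (j ∷ s) k ∨ f (k ∷ j ∷ s) k    ≡⟨ cong₂ _∨_ (ih s) (respects k (bit-swap k j s)) ⟩
      f s k ∨ f (j ∷ k ∷ s) k          ≡⟨ cong (f s k ∨_) (ih (k ∷ s)) ⟩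
      f s k ∨ f (k ∷ s) k              ≡⟨ parent s k ⟨
      f s (k + 1ℤ)                     ∎
      where open ≡-Reasoning

  prepend-below : ∀ {d} → All (_< m) d → ∀ s → f (d ++ s) m ≡ f s m
  prepend-below []               s = refl
  prepend-below (j<m ∷ all<m) s = trans (flip-below j<m _) (prepend-below all<m s)

  -- t has the lamps of d ++ s, where d lists the lamps of t ++ s below m; these are invisible at level m.
  local : AgreeFrom m s t → f s m ≡ f t m
  local {m} {s} {t} agree = trans (sym (prepend-below (all-filter (_<? m) (t ++ s)) s)) (respects m same)
    where
    d : List ℤ
    d = filter (_<? m) (t ++ s)
    same : ∀ i → bit (d ++ s) i ≡ bit t i
    same i with i <? m
    ... | yes i<m = begin
      bit (d ++ s) i                    ≡⟨ bit-++ d s i ⟩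
      bit d i xor bit s i               ≡⟨ cong (_xor bit s i) (bit-filter-∈ (_<? m) (t ++ s) i<m) ⟩
      bit (t ++ s) i xor bit s i        ≡⟨ cong (_xor bit s i) (bit-++ t s i) ⟩
      (bit t i xor bit s i) xor bit s i ≡⟨ xor-cancelʳ (bit t i) (bit s i) ⟩
      bit t i                           ∎
      where open ≡-Reasoning
    ... | no i≮m = begin
      bit (d ++ s) i                    ≡⟨ bit-++ d s i ⟩
      bit d i xor bit s i               ≡⟨ cong (_xor bit s i) (bit-filter-∉ (_<? m) (t ++ s) i≮m) ⟩
      bit s i                           ≡⟨ agree i (ℤ.≮⇒≥ i≮m) ⟩
      bit t i                           ∎
      where open ≡-Reasoning

  -- If the lamps at n differed, t would agree with the sibling n ∷ s of s.
  siblings-agree : AgreeFrom (n + 1ℤ) s t → f s n ≡ true → f t n ≡ true → AgreeFrom n s t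
  siblings-agree {n} {s} {t} agree fs ft i n≤i with i ≟ n
  ... | no i≢n   = agree i (≤∧≢⇒+1≤ n≤i i≢n)
  ... | yes refl with bit s n ≟ᵇ bit t n
  ...   | yes same = same
  ...   | no differ = contradiction (children-exclusive s n) λ excl → case trans (sym excl) both of λ ()
    where
    flipped : AgreeFrom n (n ∷ s) t
    flipped i n≤i with i ≟ n
    ... | yes refl = sym (¬-not (differ ∘ sym))
    ... | no i≢n   = agree i (≤∧≢⇒+1≤ n≤i i≢n)
    both : f s n ∧ f (n ∷ s) n ≡ true
    both = cong₂ _∧_ fs (trans (local flipped) ft)

  level-unique : f s m ≡ true → f t m ≡ true → AgreeFrom m s t
  level-unique {s} {m} {t} fs ft = downward-induction P top step (ℤ.i≤i⊔j m M) fs ft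
    where
    P : ℤ → Set
    P k = f s k ≡ true → f t k ≡ true → AgreeFrom k s t
    M : ℤ
    M = + (span s ℕ.+ span t)
    top : P (m ⊔ M)
    top _ _ = AgreeFrom-mono s t (ℤ.i≤j⊔i m M) λ i M≤i →
      trans (proj₁ (span-bounds s (ℕ.m≤m+n (span s) (span t))) i M≤i)
            (sym (proj₁ (span-bounds t (ℕ.m≤n+m (span t) (span s))) i M≤i))
    step : ∀ k → P (k + 1ℤ) → P k
    step k ih fs ft = siblings-agree (ih (ancestor fs up) (ancestor ft up)) fs ft
      where
      up : k ≤ k + 1ℤ
      up = ℤ.<⇒≤ n<n+1

  descend : f s n ≡ true → m ≤ n → ∃[ x ] f x m ≡ true × AgreeBelow m x s
  descend {s} fs =
    downward-induction (λ k → ∃[ x ] f x k ≡ true × AgreeBelow k x s) (s , fs , λ _ _ → refl) step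
    where
    step : ∀ k → ∃[ x ] f x (k + 1ℤ) ≡ true × AgreeBelow (k + 1ℤ) x s →
                 ∃[ x ] f x k ≡ true × AgreeBelow k x s
    step k (x , fx , agree) with f x k in e
    ... | true  = x , e , λ i i<k → agree i (ℤ.<-trans i<k n<n+1)
    ... | false = k ∷ x , trans (sym (trans (parent x k) (cong (_∨ f (k ∷ x) k) e))) fx ,
                  λ i i<k → trans (bit-cons-other k x i (ℤ.<⇒≢ i<k)) (agree i (ℤ.<-trans i<k n<n+1))

  marked⇒≡zeroAbove : f x m ≡ true → ∀ s → f s m ≡ zeroAbove ⟨ x ++ s , m ⟩
  marked⇒≡zeroAbove {x} {m} fx s = ⇔true⇒≡ (mk⇔
    (λ fs → from (zeroAbove-true (x ++ s) m) (from (AgreeFrom-++ m x s) (level-unique fx fs)))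
    (λ z → trans (sym (local (to (AgreeFrom-++ m x s) (to (zeroAbove-true (x ++ s) m) z)))) fx))

  unmarked-below : f [] n ≡ false → AgreeFrom n s [] → m ≤ n → f s m ≡ false
  unmarked-below f[]n vanish m≤n = ¬-not λ fs →
    contradiction (trans (sym (local vanish)) (ancestor fs m≤n)) λ e → case trans (sym e) f[]n of λ ()

  marked-window : ∀ t → f x n ≡ true → AgreeFrom n t x → n ≤ m → ∀ s → f s m ≡ zeroAbove ⟨ t ++ s , m ⟩
  marked-window {x} {n} {m} t fx agree n≤m s =
    trans (marked⇒≡zeroAbove (ancestor fx n≤m) s) (zeroAbove-local m (x ++ s) (t ++ s) same)
    where
    same : AgreeFrom m (x ++ s) (t ++ s)
    same i m≤i = trans (bit-++ x s i)
      (trans (cong (_xor bit s i) (sym (agree i (ℤ.≤-trans n≤m m≤i)))) (sym (bit-++ t s i)))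

  unmarked-window : ∀ t → f [] n ≡ false → bit t n ≡ true → AgreeFrom n s [] → m ≤ n →
                    f s m ≡ zeroAbove ⟨ t ++ s , m ⟩
  unmarked-window {n} {s} t f[]n on vanish m≤n = trans (unmarked-below f[]n vanish m≤n)
    (sym (zeroAbove-off (t ++ s) n m≤n (trans (bit-++ t s n) (cong₂ _xor_ on (vanish n ℤ.≤-refl)))))

IsBranch-cong : ∀ {f g : List ℤ → ℤ → Bool} → (∀ s n → f s n ≡ g s n) → IsBranch f → IsBranch g
IsBranch-cong f≡g branch = record
  { respects = λ {s} {t} n same → trans (sym (f≡g s n)) (trans (respects n same) (f≡g t n))
  ; cell     = λ s n → Cell-resp (f≡g _ _) (f≡g _ _) (f≡g _ _) (f≡g _ _) (cell s n) }
  where open IsBranch branch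

zeroAbove-branch : IsBranch (λ s n → zeroAbove ⟨ s , n ⟩)
zeroAbove-branch = record
  { respects = λ {s} {t} n same → zeroAbove-local n s t (λ i _ → same i)
  ; cell     = λ s n → Cell-resp (sym (zeroAbove-unfold s n)) (sym (flipped s n)) refl (sym (forgets s n))
                                 (cell-by-lamp (bit s n) (zeroAbove ⟨ s , n + 1ℤ ⟩)) }
  where
  forgets : ∀ s n → zeroAbove ⟨ n ∷ s , n + 1ℤ ⟩ ≡ zeroAbove ⟨ s , n + 1ℤ ⟩
  forgets s n = zeroAbove-local (n + 1ℤ) (n ∷ s) s (cons-agree-above n s)
  flipped : ∀ s n → zeroAbove ⟨ n ∷ s , n ⟩ ≡ bit s n ∧ zeroAbove ⟨ s , n + 1ℤ ⟩
  flipped s n = trans (zeroAbove-unfold (n ∷ s) n)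
    (cong₂ _∧_ (trans (cong not (bit-cons-self n s)) (not-involutive (bit s n))) (forgets s n))
  cell-by-lamp : ∀ x z → Cell (not x ∧ z) (x ∧ z) z z
  cell-by-lamp false z = cell⇐ (sym (∨-identityʳ z)) refl (∧-zeroʳ z)
  cell-by-lamp true  z = cell⇐ refl refl refl

-- The subshifts

leftBranch : (Lamp → Bool) → List ℤ → ℤ → Bool
leftBranch ξ s n = ξ ⟨ s , n ⟩

rightBranch : (Lamp → Bool) → List ℤ → ℤ → Bool
rightBranch ξ s n = ξ ⟨ map mirror s , - n ⟩

module _ {ξ : Lamp → Bool} (rξ : Respects ξ) where

  Ω←⇒IsBranch : Ω← ξ → IsBranch (leftBranch ξ)
  Ω←⇒IsBranch Ω = record
    { respects = λ n same → rξ (refl , same)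
    ; cell     = λ s n → Cell-resp refl (rξ (∙ab⁻¹-normal s n)) (rξ (∙a-normal s n)) (rξ (∙b-normal s n))
                                   (Ω ⟨ s , n ⟩) }

  IsBranch⇒Ω← : IsBranch (leftBranch ξ) → Ω← ξ
  IsBranch⇒Ω← branch ⟨ s , n ⟩ =
    Cell-resp refl (sym (rξ (∙ab⁻¹-normal s n))) (sym (rξ (∙a-normal s n))) (sym (rξ (∙b-normal s n)))
              (IsBranch.cell branch s n)

  via-mirror : ∀ s {m k} → m ≡ - k → ξ ⟨ s , m ⟩ ≡ rightBranch ξ (map mirror s) k
  via-mirror s e = rξ (e , λ i → sym (bit-mirror² s i))

  Ω→⇒IsBranch : Ω→ ξ → IsBranch (rightBranch ξ)
  Ω→⇒IsBranch Ω = record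
    { respects = λ {s} {t} n same →
        rξ (refl , λ i → trans (bit-mirror s i) (trans (same (mirror i)) (sym (bit-mirror t i))))
    ; cell     = λ s n →
        Cell-resp (at-a s n) (at-b s n) refl (rξ (∙ab⁻¹-normal (map mirror s) (mirror n))) (Ω (g s n)) }
    where
    g : List ℤ → ℤ → Lamp
    g s n = ⟨ map mirror s , mirror n ⟩
    at-a : ∀ s n → ξ (g s n ∙ a) ≡ rightBranch ξ s n
    at-a s n = trans (rξ (∙a-normal (map mirror s) (mirror n)))
                     (cong (λ k → ξ ⟨ map mirror s , k ⟩) (mirror+1 n))
    at-b : ∀ s n → ξ (g s n ∙ b) ≡ rightBranch ξ (n ∷ s) n
    at-b s n = trans (rξ (∙b-normal (map mirror s) (mirror n)))
                     (cong (λ k → ξ ⟨ map mirror (n ∷ s) , k ⟩) (mirror+1 n))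

  IsBranch⇒Ω→ : IsBranch (rightBranch ξ) → Ω→ ξ
  IsBranch⇒Ω→ branch ⟨ s , n ⟩ = Cell-resp
    (sym (trans (rξ (∙a-normal s n)) (via-mirror s up)))
    (sym (trans (rξ (∙b-normal s n)) (via-mirror (n ∷ s) up)))
    (sym (via-mirror s same-level))
    (sym (trans (rξ (∙ab⁻¹-normal s n)) (via-mirror (n ∷ s) same-level)))
    (IsBranch.cell branch (map mirror s) (mirror n))
    where
    up : n + 1ℤ ≡ - mirror n
    up = sym (ℤ.neg-involutive (n + 1ℤ))
    same-level : n ≡ - (mirror n + 1ℤ)
    same-level = trans (sym (ℤ.neg-involutive n)) (cong -_ (sym (mirror+1 n)))

Ω↔-η : Ω↔ η
Ω↔-η = IsBranch⇒Ω← {proj₁ ∘ η} (λ {g} {h} e → cong proj₁ (η-respects {g} {h} e)) zeroAbove-branch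
     , IsBranch⇒Ω→ {proj₂ ∘ η} (λ {g} {h} e → cong proj₂ (η-respects {g} {h} e))
                   (IsBranch-cong mirrored zeroAbove-branch)
     , linked
  where
  mirrored : ∀ s n → zeroAbove ⟨ s , n ⟩ ≡ zeroBelow ⟨ map mirror s , - n ⟩
  mirrored s n = sym (trans (zeroBelow-mirror (map mirror s) (- n))
    (cong proj₁ (η-respects {⟨ map mirror (map mirror s) , - - n ⟩} {⟨ s , n ⟩}
                            (ℤ.neg-involutive n , bit-mirror² s))))
  linked : ∀ g → (η g ≡ TT → η (g ∙ a) ≡ TT) × (η (g ∙ a) ≡ TT → η g ≡ TT)
  linked ⟨ s , n ⟩ =
    (λ e → trans step (from (η≡TT⇔ s (n + 1ℤ)) (to (η≡TT⇔ s n) e))) ,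
    (λ e → from (η≡TT⇔ s n) (to (η≡TT⇔ s (n + 1ℤ)) (trans (sym step) e)))
    where
    step : η (⟨ s , n ⟩ ∙ a) ≡ η ⟨ s , n + 1ℤ ⟩
    step = η-respects {⟨ s , n ⟩ ∙ a} {⟨ s , n + 1ℤ ⟩} (∙a-normal s n)

Ω↔Cell : Bool × Bool → Bool × Bool → Bool × Bool → Bool × Bool → Set
Ω↔Cell p q r t = Cell (proj₁ p) (proj₁ q) (proj₁ r) (proj₁ t) × Cell (proj₂ r) (proj₂ t) (proj₂ p) (proj₂ q) ×
                 ((p ≡ TT → r ≡ TT) × (r ≡ TT → p ≡ TT))

Ω↔Cell-resp : ∀ {p q r t p′ q′ r′ t′} → p ≡ p′ → q ≡ q′ → r ≡ r′ → t ≡ t′ →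
              Ω↔Cell p q r t → Ω↔Cell p′ q′ r′ t′
Ω↔Cell-resp refl refl refl refl c = c

module _ {ζ : Lamp → Bool × Bool} where

  Ω↔⇒cells : Ω↔ ζ → ∀ g → Ω↔Cell (ζ g) (ζ (g ∙ a ∙ b ⁻¹)) (ζ (g ∙ a)) (ζ (g ∙ b))
  Ω↔⇒cells (left , right , linked) g = left g , right g , linked g

  cells⇒Ω↔ : (∀ g → Ω↔Cell (ζ g) (ζ (g ∙ a ∙ b ⁻¹)) (ζ (g ∙ a)) (ζ (g ∙ b))) → Ω↔ ζ
  cells⇒Ω↔ cells = (λ g → proj₁ (cells g)) , (λ g → proj₁ (proj₂ (cells g))) , (λ g → proj₂ (proj₂ (cells g)))

Ω↔-translate : ∀ {ζ} → Respects ζ → Ω↔ ζ → ∀ g₀ → Ω↔ (λ h → ζ (g₀ ∙ h))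
Ω↔-translate {ζ} rζ Ω g₀ = cells⇒Ω↔ λ g → Ω↔Cell-resp refl
  (rζ {(g₀ ∙ g) ∙ a ∙ b ⁻¹} {g₀ ∙ (g ∙ a ∙ b ⁻¹)} ([g∙h]∙k∙l≈g∙[h∙k∙l] g₀ g a (b ⁻¹)))
  (rζ {(g₀ ∙ g) ∙ a} {g₀ ∙ (g ∙ a)} (∙-assoc g₀ g a))
  (rζ {(g₀ ∙ g) ∙ b} {g₀ ∙ (g ∙ b)} (∙-assoc g₀ g b))
  (Ω↔⇒cells Ω (g₀ ∙ g))

orbitClosure⇒Ω↔ : ∀ ζ → InOrbitClosure η ζ → Ω↔ ζ
orbitClosure⇒Ω↔ ζ closure = cells⇒Ω↔ λ g → case closure (g ∷ g ∙ a ∙ b ⁻¹ ∷ g ∙ a ∷ g ∙ b ∷ []) of λ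
  { (k , matches) → Ω↔Cell-resp
      (sym (matches (here refl))) (sym (matches (there (here refl))))
      (sym (matches (there (there (here refl))))) (sym (matches (there (there (there (here refl))))))
      (Ω↔⇒cells (Ω↔-translate {η} (λ {g} {h} → η-respects {g} {h}) Ω↔-η (k ⁻¹)) g) }

module InΩ↔ {ζ : Lamp → Bool × Bool} (rζ : Respects ζ) (Ω : Ω↔ ζ) where

  respects₁ : Respects (proj₁ ∘ ζ)
  respects₁ {g} {h} e = cong proj₁ (rζ {g} {h} e)

  respects₂ : Respects (proj₂ ∘ ζ)
  respects₂ {g} {h} e = cong proj₂ (rζ {g} {h} e)

  left : IsBranch (leftBranch (proj₁ ∘ ζ))
  left = Ω←⇒IsBranch {proj₁ ∘ ζ} respects₁ (proj₁ Ω)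

  right : IsBranch (rightBranch (proj₂ ∘ ζ))
  right = Ω→⇒IsBranch {proj₂ ∘ ζ} respects₂ (proj₁ (proj₂ Ω))

  second-via-mirror : ∀ s m → proj₂ (ζ ⟨ s , m ⟩) ≡ rightBranch (proj₂ ∘ ζ) (map mirror s) (- m)
  second-via-mirror s m = via-mirror {proj₂ ∘ ζ} respects₂ s (sym (ℤ.neg-involutive m))

  axis-linked : ∀ k → (ζ ⟨ [] , k ⟩ ≡ TT → ζ ⟨ [] , k + 1ℤ ⟩ ≡ TT) × (ζ ⟨ [] , k + 1ℤ ⟩ ≡ TT → ζ ⟨ [] , k ⟩ ≡ TT)
  axis-linked k = proj₂ (proj₂ Ω) ⟨ [] , k ⟩

  axis : ζ 𝟙 ≡ TT → ∀ n → ζ ⟨ [] , n ⟩ ≡ TT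
  axis ζ𝟙 n with ℤ.≤-total 0ℤ n
  ... | inj₁ 0≤n = upward-induction (λ k → ζ ⟨ [] , k ⟩ ≡ TT) ζ𝟙 (λ k → proj₁ (axis-linked k)) 0≤n
  ... | inj₂ n≤0 = downward-induction (λ k → ζ ⟨ [] , k ⟩ ≡ TT) ζ𝟙 (λ k → proj₂ (axis-linked k)) n≤0

  unique : ζ 𝟙 ≡ TT → ∀ g → ζ g ≡ η g
  unique ζ𝟙 ⟨ s , m ⟩ = cong₂ _,_ (Branch.marked⇒≡zeroAbove left (cong proj₁ (axis ζ𝟙 m)) s) (begin
    proj₂ (ζ ⟨ s , m ⟩)                             ≡⟨ second-via-mirror s m ⟩
    rightBranch (proj₂ ∘ ζ) (map mirror s) (- m)    ≡⟨ Branch.marked⇒≡zeroAbove right (cong proj₂ (axis ζ𝟙 (- - m))) (map mirror s) ⟩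
    zeroAbove ⟨ map mirror s , - m ⟩                ≡⟨ zeroBelow-mirror s m ⟨
    zeroBelow ⟨ s , m ⟩                             ∎)
    where open ≡-Reasoning

marked⇒translate : ∀ {ζ} → Respects ζ → Ω↔ ζ → ∀ g₀ → ζ g₀ ≡ TT → ∀ h → ζ h ≡ shift g₀ η h
marked⇒translate {ζ} rζ Ω g₀ ζg₀ h =
  trans (rζ {h} {g₀ ∙ (g₀ ⁻¹ ∙ h)} (≈-sym {g₀ ∙ (g₀ ⁻¹ ∙ h)} {h} (g∙[g⁻¹∙h]≈h g₀ h)))
        (InΩ↔.unique {λ k → ζ (g₀ ∙ k)} rζ′ (Ω↔-translate rζ Ω g₀) ζ′𝟙 (g₀ ⁻¹ ∙ h))
  where
  rζ′ : Respects (λ k → ζ (g₀ ∙ k))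
  rζ′ {k} {l} e = rζ {g₀ ∙ k} {g₀ ∙ l} (∙-cong {g₀} {g₀} {k} {l} (≈-refl {g₀}) e)
  ζ′𝟙 : ζ (g₀ ∙ 𝟙) ≡ TT
  ζ′𝟙 = trans (rζ {g₀ ∙ 𝟙} {g₀} (∙-identityʳ g₀)) ζg₀

-- Orbit closure

InWindow : ℕ → Lamp → Set
InWindow N h = (- + N ≤ pos h × pos h ≤ + N) × AgreeBelow (- + N) (lamps h) [] × AgreeFrom (+ N) (lamps h) []

∣∣≤⇒bounds : ∀ {B} → ∣ i ∣ ℕ.≤ B → - + B ≤ i × i ≤ + B
∣∣≤⇒bounds {+ _}      p       = ℤ.neg-≤-pos , +≤+ p
∣∣≤⇒bounds { -[1+ _ ]} (s≤s p) = -≤- p , -≤+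

window : ∀ F → ∃[ N ] (∀ {h} → h ∈ F → InWindow N h)
window F = N , λ {h} h∈F → in-window h (All.lookup (xs≤max 0 (map size F)) (∈-map⁺ size h∈F))
  where
  size : Lamp → ℕ
  size h = ∣ pos h ∣ ℕ.+ span (lamps h)
  N = max 0 (map size F)
  in-window : ∀ h → size h ℕ.≤ N → InWindow N h
  in-window h size≤N = ∣∣≤⇒bounds (ℕ.≤-trans (ℕ.m≤m+n _ _) size≤N) ,
    swap (span-bounds (lamps h) (ℕ.≤-trans (ℕ.m≤n+m _ _) size≤N))

InWindow-mirror : ∀ {N} s m → InWindow N ⟨ s , m ⟩ → InWindow N ⟨ map mirror s , - m ⟩
InWindow-mirror {N} s m ((lo , hi) , below , above) =
  (ℤ.neg-mono-≤ hi , subst (- m ≤_) (ℤ.neg-involutive (+ N)) (ℤ.neg-mono-≤ lo)) ,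
  AgreeFrom-mirror (+ N) s [] above ,
  subst (λ k → AgreeFrom k (map mirror s) []) (ℤ.neg-involutive (+ N)) (AgreeBelow-mirror (- + N) s [] below)

module Closure {ζ : Lamp → Bool × Bool} (rζ : Respects ζ) (Ω : Ω↔ ζ) (F : List Lamp) where
  open InΩ↔ rζ Ω
  module L = Branch left
  module R = Branch right

  f₁ f₂ : List ℤ → ℤ → Bool
  f₁ = leftBranch (proj₁ ∘ ζ)
  f₂ = rightBranch (proj₂ ∘ ζ)

  N : ℕ
  N = proj₁ (window F)

  -- the half-integer −N − 1/2, just below the window
  edge : ℤ
  edge = mirror (+ N)

  edge<-N : edge < - + N
  edge<-N = mirror-≤ ℤ.≤-refl

  ≢edge : - + N ≤ i → i ≢ edge
  ≢edge -N≤i refl = ℤ.<⇒≱ edge<-N -N≤i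

  Matched : Set
  Matched = ∃[ g ] (∀ {h} → h ∈ F → ζ h ≡ shift g η h)

  matched-at-origin : ∀ t →
    (∀ s m → InWindow N ⟨ s , m ⟩ → f₁ s m ≡ zeroAbove ⟨ t ++ s , m ⟩) →
    (∀ s m → InWindow N ⟨ s , m ⟩ → f₂ s m ≡ zeroAbove ⟨ map mirror t ++ s , m ⟩) → Matched
  matched-at-origin t first second = ⟨ t , 0ℤ ⟩ , λ {h} h∈F → trans (at h (proj₂ (window F) h∈F))
    (η-respects {⟨ t ++ lamps h , pos h ⟩} {⟨ t , 0ℤ ⟩ ⁻¹ ∙ h}
      (≈-sym {⟨ t , 0ℤ ⟩ ⁻¹ ∙ h} {⟨ t ++ lamps h , pos h ⟩} (⁻¹∙-at-origin t (lamps h) (pos h))))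
    where
    at : ∀ h → InWindow N h → ζ h ≡ η ⟨ t ++ lamps h , pos h ⟩
    at ⟨ s , m ⟩ inside = cong₂ _,_ (first s m inside) (begin
      proj₂ (ζ ⟨ s , m ⟩)                                 ≡⟨ second-via-mirror s m ⟩
      f₂ (map mirror s) (- m)                             ≡⟨ second (map mirror s) (- m) (InWindow-mirror s m inside) ⟩
      zeroAbove ⟨ map mirror t ++ map mirror s , - m ⟩    ≡⟨ cong (λ l → zeroAbove ⟨ l , - m ⟩) (map-++ mirror t s) ⟨
      zeroAbove ⟨ map mirror (t ++ s) , - m ⟩             ≡⟨ zeroBelow-mirror (t ++ s) m ⟨
      zeroBelow ⟨ t ++ s , m ⟩                            ∎)
      where open ≡-Reasoning

  both-marked : f₁ [] (+ N) ≡ true → f₂ [] (+ N) ≡ true → Matched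
  both-marked e₁ e₂ with L.descend e₁ ℤ.neg-≤-pos
  ... | x , fx , x-below = g₀ , λ {h} _ → marked⇒translate rζ Ω g₀ (cong₂ _,_ fx second) h
    where
    g₀ : Lamp
    g₀ = ⟨ x , - + N ⟩
    second : proj₂ (ζ g₀) ≡ true
    second = trans (second-via-mirror x (- + N)) (trans (R.local (AgreeBelow-mirror (- + N) x [] x-below))
               (trans (cong (f₂ []) (ℤ.neg-involutive (+ N))) e₂))

  left-marked : f₁ [] (+ N) ≡ true → f₂ [] (+ N) ≡ false → Matched
  left-marked e₁ e₂ with L.descend e₁ ℤ.neg-≤-pos
  ... | x , fx , x-below = matched-at-origin (edge ∷ x)
    (λ s m ((lo , _) , _) → L.marked-window (edge ∷ x) fx (λ i -N≤i → bit-cons-other edge x i (≢edge -N≤i)) lo s)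
    (λ s m ((_ , hi) , _ , above) → R.unmarked-window (map mirror (edge ∷ x)) e₂ on above hi)
    where
    on : bit (map mirror (edge ∷ x)) (+ N) ≡ true
    on = trans (bit-mirror (edge ∷ x) (+ N)) (trans (bit-cons-self edge x) (cong not (x-below edge edge<-N)))

  right-marked : f₁ [] (+ N) ≡ false → f₂ [] (+ N) ≡ true → Matched
  right-marked e₁ e₂ with R.descend e₂ ℤ.neg-≤-pos
  ... | x , fx , x-below = matched-at-origin (+ N ∷ map mirror x)
    (λ s m ((_ , hi) , _ , above) → L.unmarked-window (+ N ∷ map mirror x) e₁ on above hi)
    (λ s m ((lo , _) , _) → R.marked-window (edge ∷ map mirror (map mirror x)) fx agree lo s)
    where
    on : bit (+ N ∷ map mirror x) (+ N) ≡ true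
    on = trans (bit-cons-self (+ N) (map mirror x)) (cong not (trans (bit-mirror x (+ N)) (x-below edge edge<-N)))
    agree : AgreeFrom (- + N) (edge ∷ map mirror (map mirror x)) x
    agree i -N≤i = trans (bit-cons-other edge (map mirror (map mirror x)) i (≢edge -N≤i)) (bit-mirror² x i)

  none-marked : f₁ [] (+ N) ≡ false → f₂ [] (+ N) ≡ false → Matched
  none-marked e₁ e₂ = matched-at-origin (+ N ∷ edge ∷ [])
    (λ s m ((_ , hi) , _ , above) → L.unmarked-window (+ N ∷ edge ∷ []) e₁ on₁ above hi)
    (λ s m ((_ , hi) , _ , above) → R.unmarked-window (map mirror (+ N ∷ edge ∷ [])) e₂ on₂ above hi)
    where
    on₁ : bit (+ N ∷ edge ∷ []) (+ N) ≡ true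
    on₁ = trans (bit-cons-self (+ N) (edge ∷ [])) (cong not (bit-cons-other edge [] (+ N) (≢edge ℤ.neg-≤-pos)))
    on₂ : bit (map mirror (+ N ∷ edge ∷ [])) (+ N) ≡ true
    on₂ = trans (bit-mirror (+ N ∷ edge ∷ []) (+ N))
      (trans (bit-cons-other (+ N) (edge ∷ []) edge (≢edge ℤ.neg-≤-pos ∘ sym)) (bit-cons-self edge []))

  matched : Matched
  matched with f₁ [] (+ N) in e₁ | f₂ [] (+ N) in e₂
  ... | true  | true  = both-marked e₁ e₂
  ... | true  | false = left-marked e₁ e₂
  ... | false | true  = right-marked e₁ e₂
  ... | false | false = none-marked e₁ e₂

lemma6p3 : Respects η
    × (∀ (ζ : Lamp → Bool × Bool) → Respects ζ →
         (Ω↔ ζ → InOrbitClosure η ζ) × (InOrbitClosure η ζ → Ω↔ ζ))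
    × Ω↔ η × η 𝟙 ≡ (true , true)
    × (∀ (ζ : Lamp → Bool × Bool) → Respects ζ → Ω↔ ζ → ζ 𝟙 ≡ (true , true) →
         ∀ g → ζ g ≡ η g)
lemma6p3 =
    (λ {g} {h} → η-respects {g} {h})
  , (λ ζ rζ → (λ Ω → Closure.matched {ζ} rζ Ω) , orbitClosure⇒Ω↔ ζ)
  , Ω↔-η
  , refl
  , (λ ζ rζ Ω → InΩ↔.unique {ζ} rζ Ω)
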